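{- Let $\mathcal I=(G,D,k,h)$ be an $\ell$-$\mathrm{TEDSC}$ instance with $h\ge |V(G)|\cdot|D|$. Then $\mathcal I$ is feasible if and only if the $\mathrm{TEDSC}$ instance $(G,D,k)$ is feasible.
   Context: Let $G=(V,E)$ be a directed static graph. A draft schedule $D$ is a finite set of demands $(u,v,t)$ with $(u,v)\in E$, $t\in\mathbb N^+$; $\Lambda(D)=\max t$. In $\mathcal G(G,D)$ every edge is available at every time step $1,\dots,\Lambda(D)$. A (strict) temporal walk $p$ is $(v_0,t_0),\dots,(v_r,t_r)$ with $t_0<\dots<t_r$, $(v_{i-1},v_i)\in E$, $t_{i-1}\in[\Lambda(D)]$; time-edges $((v_{i-1},v_i),t_{i-1})$; length $\ell(p)=r$. A schedule is a set $S$ of walks pairwise sharing no time-edge; it extends $D$ if each demand $(u,v,t)$ is a time-edge $((u,v),t)$ of some walk of $S$. The $\mathrm{TEDSC}$ instance $(G,D,k)$ is feasible if some schedule extending $D$ has $|S|\le k$; the $\ell$-$\mathrm{TEDSC}$ instance $(G,D,k,h)$ is feasible if some schedule extending $D$ has $|S|\le k$ and $\ell(p)\le h$ for all $p\in S$. -}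

module Defs where

open import Data.Nat using (ℕ; suc; _≤_; _<_; _⊔_)
open import Data.Fin using (Fin)
open import Data.Product using (_×_; _,_; Σ; ∃-syntax)
open import Data.List using (List; []; _∷_; length; foldr; map)
open import Data.List.Membership.Propositional using (_∈_)
open import Data.List.Relation.Unary.All using (All)
open import Data.List.Relation.Unary.Unique.Propositional using (Unique)
open import Relation.Nullary using (¬_)
open import Relation.Binary.PropositionalEquality using (_≡_)
import Data.List
open import Data.Unit using (⊤)

record Graph : Set₁ where
  field
    n : ℕ
    E : Fin n → Fin n → Set

open Graph public

Demand : Graph → Set
Demand G = Fin (n G) × Fin (n G) × ℕ

TimeEdge : Graph → Set
TimeEdge G = (Fin (n G) × Fin (n G)) × ℕ

record DraftSchedule (G : Graph) : Set where
  field
    demands : List (Demand G)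
    unique  : Unique demands
    valid   : All (λ { (u , v , t) → E G u v × 1 ≤ t }) demands

open DraftSchedule public

∣_∣D : ∀ {G} → DraftSchedule G → ℕ
∣ D ∣D = length (demands D)

-- Λ(D) = max t  (0 for the empty draft schedule)
Λ : ∀ {G} → DraftSchedule G → ℕ
Λ D = foldr (λ { (_ , _ , t) m → t ⊔ m }) 0 (demands D)

record Walk (G : Graph) : Set where
  constructor walk
  field
    start : Fin (n G) × ℕ
    steps : List (Fin (n G) × ℕ)

open Walk public

timeEdgesFrom : (G : Graph) → Fin (n G) × ℕ → List (Fin (n G) × ℕ) → List (TimeEdge G)
timeEdgesFrom G (v , t) [] = []
timeEdgesFrom G (v , t) ((w , s) ∷ ps) = ((v , w) , t) ∷ timeEdgesFrom G (w , s) ps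

timeEdges : ∀ {G} → Walk G → List (TimeEdge G)
timeEdges {G} p = timeEdgesFrom G (start p) (steps p)

ℓ : ∀ {G} → Walk G → ℕ
ℓ p = length (steps p)

-- Validity of a temporal walk in 𝒢(G,D) (every edge available at every
-- time step 1..Λ(D)): strictly increasing times, consecutive pairs are edges,
-- and every departure time t_{i-1} lies in [Λ(D)] = {1,…,Λ(D)}.
ValidFrom : (G : Graph) → ℕ → Fin (n G) × ℕ → List (Fin (n G) × ℕ) → Set
ValidFrom G L (v , t) [] = ⊤
ValidFrom G L (v , t) ((w , s) ∷ ps) =
  t < s × E G v w × 1 ≤ t × t ≤ L × ValidFrom G L (w , s) ps

IsTemporalWalk : (G : Graph) → DraftSchedule G → Walk G → Set
IsTemporalWalk G D p = ValidFrom G (Λ D) (start p) (steps p)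

record Schedule (G : Graph) (D : DraftSchedule G) : Set where
  field
    walks    : List (Walk G)
    temporal : All (IsTemporalWalk G D) walks
    disjoint : ∀ (i j : Fin (length walks)) → ¬ (i ≡ j) →
               ∀ (e : TimeEdge G) →
               e ∈ timeEdges (Data.List.lookup walks i) →
               ¬ (e ∈ timeEdges (Data.List.lookup walks j))

open Schedule public

Extends : ∀ {G D} → Schedule G D → Set
Extends {G} {D} S =
  All (λ { (u , v , t) → ∃[ p ] (p ∈ walks S × ((u , v) , t) ∈ timeEdges p) })
      (demands D)

TEDSC-Feasible : (G : Graph) → DraftSchedule G → ℕ → Set
TEDSC-Feasible G D k =
  Σ (Schedule G D) λ S → Extends S × length (walks S) ≤ k

ℓTEDSC-Feasible : (G : Graph) → DraftSchedule G → ℕ → ℕ → Set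
ℓTEDSC-Feasible G D k h =
  Σ (Schedule G D) λ S → Extends S × length (walks S) ≤ k
                        × All (λ p → ℓ p ≤ h) (walks S)

-- A temporal walk can be shortened, using only its own time-edges, so that it keeps all
-- of its demand time-edges.  Process it from the end: drop everything after the last demand
-- time-edge, and on each demand-free stretch leading to a demand time-edge erase loops, i.e.
-- when a vertex is visited twice, let the walk enter its later visit directly.  The time-edge
-- entering the later visit is one the walk already used (it only depends on the vertex and the
-- departure time), and times still increase.  Each stretch then has at most n edges, and the
-- demand time-edges of a walk are distinct because its times strictly increase, so the
-- shortened walk has length at most n·|D|.  Shortening every walk of a schedule only shrinks
-- the time-edge sets, so the result is again a schedule extending D.

module Submission where

open import Defs
open import Data.Nat using (ℕ; suc; _+_; _*_; _≤_; z≤n; s≤s)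
import Data.Nat as ℕ
open import Data.Nat.Properties
open import Data.Fin using (Fin; cast)
import Data.Fin.Properties as Fin
open import Data.Product using (_×_; _,_; Σ; proj₁; proj₂)
open import Data.Product.Properties using (≡-dec)
open import Data.Sum using (inj₁; inj₂)
open import Data.Maybe using (Maybe; just; nothing; maybe′)
open import Data.List using (List; []; _∷_; length; map; _++_; filter; lookup)
open import Data.List.Properties using (length-map; length-++; length-++-sucʳ; length-tabulate; filter-accept; filter-reject)
open import Data.List.Membership.Propositional using (_∈_; _∉_)
open import Data.List.Membership.Propositional.Properties using (∈-map⁺; ∈-++⁺ˡ; ∈-++⁺ʳ; ∈-++⁻; ∈-∃++; ∈-allFin; ∈-filter⁻)
open import Data.List.Relation.Binary.Subset.Propositional using (_⊆_)
open import Data.List.Relation.Unary.All as All using (All; []; _∷_)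
open import Data.List.Relation.Unary.All.Properties using (anti-mono; ¬Any⇒All¬; map⁺)
open import Data.List.Relation.Unary.Any using (here; there)
open import Data.List.Relation.Unary.Unique.Propositional using (Unique)
open import Data.List.Relation.Unary.Unique.Propositional.Properties using (filter⁺)
open import Data.List.Relation.Unary.AllPairs using ([]; _∷_)
open import Data.Unit using (tt)
open import Function using (id; _∘_)
open import Function.Bundles using (_⇔_; mk⇔)
open import Relation.Binary.Definitions using (DecidableEquality)
open import Relation.Binary.PropositionalEquality using (_≡_; refl; sym; trans; cong; subst; module ≡-Reasoning)
open import Relation.Nullary using (yes; no; contradiction)

Unique-⊆⇒length≤ : {A : Set} {xs ys : List A} → Unique xs → xs ⊆ ys → length xs ≤ length ys
Unique-⊆⇒length≤ {xs = []} _ _ = z≤n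
Unique-⊆⇒length≤ {xs = x ∷ xs} (x∉xs ∷ u) xs⊆ys with ∈-∃++ (xs⊆ys (here refl))
... | ys₁ , ys₂ , refl = begin
  suc (length xs)           ≤⟨ s≤s (Unique-⊆⇒length≤ u xs⊆ys₁ys₂) ⟩
  suc (length (ys₁ ++ ys₂)) ≡⟨ sym (length-++-sucʳ ys₁ x ys₂) ⟩
  length (ys₁ ++ x ∷ ys₂)   ∎
  where
  open ≤-Reasoning
  xs⊆ys₁ys₂ : xs ⊆ ys₁ ++ ys₂
  xs⊆ys₁ys₂ z∈xs with ∈-++⁻ ys₁ (xs⊆ys (there z∈xs))
  ... | inj₁ z∈ys₁         = ∈-++⁺ˡ z∈ys₁
  ... | inj₂ (here refl)   = contradiction refl (All.lookup x∉xs z∈xs)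
  ... | inj₂ (there z∈ys₂) = ∈-++⁺ʳ ys₁ z∈ys₂

Unique⇒length≤ : ∀ {n} {vs : List (Fin n)} → Unique vs → length vs ≤ n
Unique⇒length≤ {n} u =
  ≤-trans (Unique-⊆⇒length≤ u (λ {v} _ → ∈-allFin v)) (≤-reflexive (length-tabulate id))

cast-injective : ∀ {m n} .(eq : m ≡ n) {i j : Fin m} → cast eq i ≡ cast eq j → i ≡ j
cast-injective eq {i} {j} i≡j = begin
  i                         ≡⟨ sym (Fin.cast-involutive (sym eq) eq i) ⟩
  cast (sym eq) (cast eq i) ≡⟨ cong (cast (sym eq)) i≡j ⟩
  cast (sym eq) (cast eq j) ≡⟨ Fin.cast-involutive (sym eq) eq j ⟩
  j                         ∎
  where open ≡-Reasoning

lookup-map : {A B : Set} (f : A → B) (xs : List A) (i : Fin (length (map f xs))) →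
             lookup (map f xs) i ≡ f (lookup xs (cast (length-map f xs) i))
lookup-map f (x ∷ xs) Fin.zero    = refl
lookup-map f (x ∷ xs) (Fin.suc i) = lookup-map f xs i

mapSchedule : ∀ {G D} (f : Walk G → Walk G) →
              (∀ p → timeEdges (f p) ⊆ timeEdges p) →
              (∀ {p} → IsTemporalWalk G D p → IsTemporalWalk G D (f p)) →
              Schedule G D → Schedule G D
mapSchedule f f-⊆ f-temporal S = record
  { walks    = map f (walks S)
  ; temporal = map⁺ (All.map f-temporal (temporal S))
  ; disjoint = λ i j i≢j e e∈i e∈j →
      disjoint S (index i) (index j) (i≢j ∘ cast-injective _) e (fromMapped i e∈i) (fromMapped j e∈j)
  }
  where
  index : Fin (length (map f (walks S))) → Fin (length (walks S))
  index = cast (length-map f (walks S))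
  fromMapped : ∀ i {e} → e ∈ timeEdges (lookup (map f (walks S)) i) →
               e ∈ timeEdges (lookup (walks S) (index i))
  fromMapped i {e} e∈ =
    f-⊆ _ (subst (λ p → e ∈ timeEdges p) (lookup-map f (walks S) i) e∈)

demandTimeEdge : ∀ {G} → Demand G → TimeEdge G
demandTimeEdge (u , v , t) = ((u , v) , t)

module Shortening (G : Graph) (L : ℕ) (DL : List (TimeEdge G)) where

  Point : Set
  Point = Fin (n G) × ℕ

  vertex : Point → Fin (n G)
  vertex = proj₁

  time : Point → ℕ
  time = proj₂

  edge : Point → Point → TimeEdge G
  edge x y = ((vertex x , vertex y) , time x)

  edge-cong : ∀ x y z → vertex y ≡ vertex z → edge x y ≡ edge x z
  edge-cong x _ _ = cong (λ v → ((vertex x , v) , time x))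

  edgesFrom : Point → List Point → List (TimeEdge G)
  edgesFrom = timeEdgesFrom G

  Valid : Point → List Point → Set
  Valid = ValidFrom G L

  _≟ₑ_ : DecidableEquality (TimeEdge G)
  _≟ₑ_ = ≡-dec (≡-dec Fin._≟_ Fin._≟_) ℕ._≟_

  open import Data.List.Membership.DecPropositional _≟ₑ_ using (_∈?_)

  DemandFree : List (TimeEdge G) → Set
  DemandFree = All (_∉ DL)

  demandCount : Point → List Point → ℕ
  demandCount x ps = length (filter (_∈? DL) (edgesFrom x ps))

  demandCount-accept : ∀ {x y ps} → edge x y ∈ DL →
                       demandCount x (y ∷ ps) ≡ suc (demandCount y ps)
  demandCount-accept x→y = cong length (filter-accept (_∈? DL) x→y)

  demandCount-reject : ∀ {x y ps} → edge x y ∉ DL → demandCount x (y ∷ ps) ≡ demandCount y ps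
  demandCount-reject x↛y = cong length (filter-reject (_∈? DL) x↛y)

  edgesFrom-later : ∀ {x ps} → Valid x ps → All (λ e → time x ≤ proj₂ e) (edgesFrom x ps)
  edgesFrom-later {ps = []}    _                     = []
  edgesFrom-later {ps = _ ∷ _} (x<y , _ , _ , _ , v) =
    ≤-refl ∷ All.map (≤-trans (<⇒≤ x<y)) (edgesFrom-later v)

  edgesFrom-unique : ∀ {x ps} → Valid x ps → Unique (edgesFrom x ps)
  edgesFrom-unique {ps = []}    _                     = []
  edgesFrom-unique {ps = _ ∷ _} (x<y , _ , _ , _ , v) =
    All.map (λ y≤e x→y≡e → <-irrefl (cong proj₂ x→y≡e) (<-≤-trans x<y y≤e)) (edgesFrom-later v)
    ∷ edgesFrom-unique v

  demandCount≤ : ∀ {x ps} → Valid x ps → demandCount x ps ≤ length DL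
  demandCount≤ {x} {ps} v =
    Unique-⊆⇒length≤ (filter⁺ (_∈? DL) (edgesFrom-unique v))
                     (proj₂ ∘ ∈-filter⁻ (_∈? DL) {xs = edgesFrom x ps})

  prepend-⊆ : ∀ {x q y Q ps} → vertex q ≡ vertex y →
              edgesFrom q Q ⊆ edgesFrom y ps → edgesFrom x (q ∷ Q) ⊆ edgesFrom x (y ∷ ps)
  prepend-⊆ {x} {q} {y} q≈y _   (here refl) = here (edge-cong x q y q≈y)
  prepend-⊆             _   sub (there e∈)  = there (sub e∈)

  prepend-⊇ : ∀ {x q y Q ps e} → vertex q ≡ vertex y →
              (e ∈ edgesFrom y ps → e ∈ edgesFrom q Q) →
              e ∈ edgesFrom x (y ∷ ps) → e ∈ edgesFrom x (q ∷ Q)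
  prepend-⊇ {x} {q} {y} q≈y _   (here refl) = here (edge-cong x y q (sym q≈y))
  prepend-⊇             _   sup (there e∈)  = there (sup e∈)

  infix 4 _≼_

  data _≼_ : Walk G → Walk G → Set where
    ≼-refl : ∀ {p} → p ≼ p
    ≼-step : ∀ {w x y V} → w ≼ walk y V → w ≼ walk x (y ∷ V)

  ≼-timeEdges : ∀ {w p} → w ≼ p → timeEdges w ⊆ timeEdges p
  ≼-timeEdges ≼-refl      = id
  ≼-timeEdges (≼-step w≼) = there ∘ ≼-timeEdges w≼

  ≼-++ : ∀ {z Z q Q R} → walk z Z ≼ walk q Q → walk z (Z ++ R) ≼ walk q (Q ++ R)
  ≼-++ ≼-refl      = ≼-refl
  ≼-++ (≼-step w≼) = ≼-step (≼-++ w≼)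

  ≼-valid : ∀ {w x V} → w ≼ walk x V → Valid x V →
            time x ≤ time (start w) × Valid (start w) (steps w)
  ≼-valid ≼-refl      v = ≤-refl , v
  ≼-valid (≼-step w≼) (x<y , _ , _ , _ , vy) with ≼-valid w≼ vy
  ... | y≤w , vw = ≤-trans (<⇒≤ x<y) y≤w , vw

  ≼-unique : ∀ {w x V} → w ≼ walk x V → Unique (map vertex (x ∷ V)) →
             Unique (map vertex (start w ∷ steps w))
  ≼-unique ≼-refl      u       = u
  ≼-unique (≼-step w≼) (_ ∷ u) = ≼-unique w≼ u

  ≼-demands : ∀ {z Z x V R e} → walk z Z ≼ walk x V → DemandFree (edgesFrom x V) →
              e ∈ DL → e ∈ edgesFrom x (V ++ R) → e ∈ edgesFrom z (Z ++ R)
  ≼-demands ≼-refl       _          _   e∈          = e∈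
  ≼-demands (≼-step _)  (x↛y ∷ _)  e∈D (here refl) = contradiction e∈D x↛y
  ≼-demands (≼-step w≼) (_ ∷ free) e∈D (there e∈)  = ≼-demands w≼ free e∈D e∈

  data LoopErasure (x q : Point) (Q : List Point) : Walk G → Set where
    fresh : vertex x ∉ map vertex (q ∷ Q) → LoopErasure x q Q (walk x (q ∷ Q))
    cut   : ∀ {w} → w ≼ walk q Q → vertex (start w) ≡ vertex x → LoopErasure x q Q w

  loopErase : ∀ x q Q → Σ (Walk G) (LoopErasure x q Q)
  loopErase x q Q with vertex x Fin.≟ vertex q
  ... | yes x≈q = walk q Q , cut ≼-refl (sym x≈q)
  loopErase x q []      | no x≉q = walk x (q ∷ []) , fresh λ { (here x≈q) → x≉q x≈q }
  loopErase x q (r ∷ R) | no x≉q with loopErase x r R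
  ... | _ , fresh x∉ =
    walk x (q ∷ r ∷ R) , fresh λ { (here x≈q) → x≉q x≈q ; (there x∈) → x∉ x∈ }
  ... | w , cut w≼ w≈x = w , cut (≼-step w≼) w≈x

  -- The walk first, approach ++ anchor ∷ rest, split where its first demand time-edge ends.
  record Shape : Set where
    constructor shape
    field
      first    : Point
      approach : List Point
      anchor   : Point
      rest     : List Point

  open Shape

  body : Shape → List Point
  body s = approach s ++ anchor s ∷ rest s

  toWalk : Shape → Walk G
  toWalk s = walk (first s) (body s)

  -- Prepending a non-demand point x: if x's vertex recurs on the approach, start there instead.
  extend : Point → Shape → Shape
  extend x (shape q Q b T) with loopErase x q Q
  ... | w , _ = shape (start w) (steps w) b T

  shorten : Point → List Point → Maybe Shape
  shorten x []       = nothing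
  shorten x (y ∷ ps) with edge x y ∈? DL | shorten y ps
  ... | yes _ | nothing = just (shape x [] y [])
  ... | yes _ | just s  = just (shape x [] (first s) (body s))
  ... | no _  | nothing = nothing
  ... | no _  | just s  = just (extend x s)

  -- rest-bound leaves room n G for the loop-free approach and the demand time-edge closing it.
  record IsShortening (x : Point) (ps : List Point) (s : Shape) : Set where
    field
      sameVertex        : vertex (first s) ≡ vertex x
      edges⊆            : timeEdges (toWalk s) ⊆ edgesFrom x ps
      demands⊆          : ∀ {e} → e ∈ DL → e ∈ edgesFrom x ps → e ∈ timeEdges (toWalk s)
      approach-free     : DemandFree (edgesFrom (first s) (approach s))
      approach-loopFree : Unique (map vertex (first s ∷ approach s))
      rest-bound        : length (rest s) + n G ≤ n G * demandCount x ps
      valid             : Valid x ps → time x ≤ time (first s) × Valid (first s) (body s)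

  open IsShortening

  prepend-valid : ∀ {x y ps s} → IsShortening y ps s → Valid x (y ∷ ps) → Valid x (first s ∷ body s)
  prepend-valid {x} sh (x<y , x→y , 1≤x , x≤L , vy) =
    let (y≤s , vs) = valid sh vy
    in  <-≤-trans x<y y≤s , subst (E G (vertex x)) (sym (sameVertex sh)) x→y , 1≤x , x≤L , vs

  ShortenSpec : Point → List Point → Maybe Shape → Set
  ShortenSpec x ps nothing  = DemandFree (edgesFrom x ps)
  ShortenSpec x ps (just s) = IsShortening x ps s

  body-bound : ∀ {x ps s} → IsShortening x ps s → length (body s) ≤ n G * demandCount x ps
  body-bound {x} {ps} {shape q Q b T} sh = begin
    length (Q ++ b ∷ T)        ≡⟨ length-++ Q ⟩
    length Q + suc (length T)  ≡⟨ +-suc (length Q) (length T) ⟩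
    suc (length Q) + length T  ≤⟨ +-monoˡ-≤ (length T) approach≤n ⟩
    n G + length T             ≡⟨ +-comm (n G) (length T) ⟩
    length T + n G             ≤⟨ rest-bound sh ⟩
    n G * demandCount x ps     ∎
    where
    open ≤-Reasoning
    approach≤n : suc (length Q) ≤ n G
    approach≤n = subst (_≤ n G) (length-map vertex (q ∷ Q)) (Unique⇒length≤ (approach-loopFree sh))

  single-demand : ∀ {x y ps} → edge x y ∈ DL → DemandFree (edgesFrom y ps) →
                  IsShortening x (y ∷ ps) (shape x [] y [])
  single-demand {y = y} {ps} x→y free = record
    { sameVertex        = refl
    ; edges⊆            = λ { (here refl) → here refl }
    ; demands⊆          = λ { _   (here refl) → here refl
                            ; e∈D (there e∈)  → contradiction e∈D (All.lookup free e∈) }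
    ; approach-free     = []
    ; approach-loopFree = [] ∷ []
    ; rest-bound        = subst (λ c → n G ≤ n G * c) (sym (demandCount-accept x→y))
                                (m≤m*n (n G) (suc (demandCount y ps)))
    ; valid             = λ { (x<y , x→y , 1≤x , x≤L , _) →
                                ≤-refl , (x<y , x→y , 1≤x , x≤L , tt) }
    }

  demand-then : ∀ {x y ps s} → edge x y ∈ DL → IsShortening y ps s →
                IsShortening x (y ∷ ps) (shape x [] (first s) (body s))
  demand-then {s = s} x→y sh = record
    { sameVertex        = refl
    ; edges⊆            = prepend-⊆ (sameVertex sh) (edges⊆ sh)
    ; demands⊆          = λ e∈D → prepend-⊇ (sameVertex sh) (demands⊆ sh e∈D)
    ; approach-free     = []
    ; approach-loopFree = [] ∷ []
    ; rest-bound        = subst (λ c → length (body s) + n G ≤ n G * c) (sym (demandCount-accept x→y))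
                            (≤-trans (+-monoˡ-≤ (n G) (body-bound sh))
                                     (≤-reflexive (trans (+-comm _ (n G)) (sym (*-suc (n G) _)))))
    ; valid             = λ v → ≤-refl , prepend-valid sh v
    }

  extend-rest-bound : ∀ {x y ps s} → edge x y ∉ DL → IsShortening y ps s →
                      length (rest s) + n G ≤ n G * demandCount x (y ∷ ps)
  extend-rest-bound {s = s} x↛y sh =
    subst (λ c → length (rest s) + n G ≤ n G * c) (sym (demandCount-reject x↛y)) (rest-bound sh)

  extend-correct : ∀ {x y ps s} → edge x y ∉ DL → IsShortening y ps s →
                   IsShortening x (y ∷ ps) (extend x s)
  extend-correct {x} {y} {s = shape q Q b T} x↛y sh with loopErase x q Q
  ... | _ , fresh x∉ = record
    { sameVertex        = refl
    ; edges⊆            = prepend-⊆ (sameVertex sh) (edges⊆ sh)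
    ; demands⊆          = λ e∈D → prepend-⊇ (sameVertex sh) (demands⊆ sh e∈D)
    ; approach-free     = (x↛y ∘ subst (_∈ DL) (edge-cong x q y (sameVertex sh))) ∷ approach-free sh
    ; approach-loopFree = ¬Any⇒All¬ _ x∉ ∷ approach-loopFree sh
    ; rest-bound        = extend-rest-bound x↛y sh
    ; valid             = λ v → ≤-refl , prepend-valid sh v
    }
  ... | w , cut w≼ w≈x = record
    { sameVertex        = w≈x
    ; edges⊆            = there ∘ edges⊆ sh ∘ ≼-timeEdges (≼-++ w≼)
    ; demands⊆          = λ { e∈D (here refl) → contradiction e∈D x↛y
                            ; e∈D (there e∈)  →
                                ≼-demands w≼ (approach-free sh) e∈D (demands⊆ sh e∈D e∈) }
    ; approach-free     = anti-mono (≼-timeEdges w≼) (approach-free sh)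
    ; approach-loopFree = ≼-unique w≼ (approach-loopFree sh)
    ; rest-bound        = extend-rest-bound x↛y sh
    ; valid             = λ { (x<y , _ , _ , _ , vy) →
                                let (y≤q , vq) = valid sh vy
                                    (q≤w , vw) = ≼-valid (≼-++ w≼) vq
                                in  <⇒≤ (<-≤-trans x<y (≤-trans y≤q q≤w)) , vw }
    }

  shorten-correct : ∀ x ps → ShortenSpec x ps (shorten x ps)
  shorten-correct x []       = []
  shorten-correct x (y ∷ ps) with edge x y ∈? DL | shorten y ps | shorten-correct y ps
  ... | yes x→y | nothing | free = single-demand x→y free
  ... | yes x→y | just _  | sh   = demand-then x→y sh
  ... | no x↛y  | nothing | free = x↛y ∷ free
  ... | no x↛y  | just _  | sh   = extend-correct x↛y sh

  shortenWalk : Walk G → Walk G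
  shortenWalk (walk x ps) = maybe′ toWalk (walk x []) (shorten x ps)

  shortenWalk-⊆ : ∀ p → timeEdges (shortenWalk p) ⊆ timeEdges p
  shortenWalk-⊆ (walk x ps) with shorten x ps | shorten-correct x ps
  ... | nothing | _  = λ ()
  ... | just _  | sh = edges⊆ sh

  shortenWalk-demands : ∀ p {e} → e ∈ DL → e ∈ timeEdges p → e ∈ timeEdges (shortenWalk p)
  shortenWalk-demands (walk x ps) e∈D e∈ with shorten x ps | shorten-correct x ps
  ... | nothing | free = contradiction e∈D (All.lookup free e∈)
  ... | just _  | sh   = demands⊆ sh e∈D e∈

  shortenWalk-valid : ∀ p → Valid (start p) (steps p) →
                      Valid (start (shortenWalk p)) (steps (shortenWalk p))
  shortenWalk-valid (walk x ps) v with shorten x ps | shorten-correct x ps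
  ... | nothing | _  = tt
  ... | just _  | sh = proj₂ (valid sh v)

  shortenWalk-length : ∀ p → Valid (start p) (steps p) → ℓ (shortenWalk p) ≤ n G * length DL
  shortenWalk-length (walk x ps) v with shorten x ps | shorten-correct x ps
  ... | nothing | _  = z≤n
  ... | just _  | sh = ≤-trans (body-bound sh) (*-monoʳ-≤ (n G) (demandCount≤ v))

mainTheorem19 : (G : Graph) (D : DraftSchedule G) (k h : ℕ) →
    n G * ∣ D ∣D ≤ h →
    (ℓTEDSC-Feasible G D k h ⇔ TEDSC-Feasible G D k)
mainTheorem19 G D k h n|D|≤h = mk⇔ forgetLengths shortenAll
  where
  forgetLengths : ℓTEDSC-Feasible G D k h → TEDSC-Feasible G D k
  forgetLengths (S , S⊇D , |S|≤k , _) = S , S⊇D , |S|≤k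

  DL : List (TimeEdge G)
  DL = map (demandTimeEdge {G}) (demands D)

  n|DL|≤h : n G * length DL ≤ h
  n|DL|≤h = subst (λ m → n G * m ≤ h) (sym (length-map (demandTimeEdge {G}) (demands D))) n|D|≤h

  open Shortening G (Λ D) DL

  shortenAll : TEDSC-Feasible G D k → ℓTEDSC-Feasible G D k h
  shortenAll (S , S⊇D , |S|≤k) = S′ , S′⊇D , |S′|≤k , short
    where
    S′ : Schedule G D
    S′ = mapSchedule shortenWalk shortenWalk-⊆ (λ {p} → shortenWalk-valid p) S
    S′⊇D : Extends S′
    S′⊇D = All.tabulate λ { {u , v , t} d∈D → let (p , p∈S , d∈p) = All.lookup S⊇D d∈D in
             shortenWalk p , ∈-map⁺ shortenWalk p∈S ,
             shortenWalk-demands p (∈-map⁺ (demandTimeEdge {G}) d∈D) d∈p }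
    |S′|≤k : length (walks S′) ≤ k
    |S′|≤k = subst (_≤ k) (sym (length-map shortenWalk (walks S))) |S|≤k
    short : All (λ p → ℓ p ≤ h) (walks S′)
    short = map⁺ (All.map (λ {p} v → ≤-trans (shortenWalk-length p v) n|DL|≤h) (temporal S))
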